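{- Let $G,H$ be finite digraphs and $\xi\in\mathcal{H}(G,H)$. Then the homomorphism $\iota_\xi:\mathcal{G}(\xi)\to H$ is strict.
   Context: Digraphs $G=(V(G),A(G))$: finite non-empty $V(G)$, $A(G)\subseteq V(G)\times V(G)$; an arc $vw$ is proper if $v\ne w$. $\mathcal{H}(G,H)$: homomorphisms (maps with $\xi(v)\xi(w)\in A(H)$ for $vw\in A(G)$); strict = mapping every proper arc to a proper arc. $v,w$ adjacent if $vw$ or $wv$ is an arc. For $X\subseteq V(G)$, $v\in X$, $\gamma_X(v)$ = set of $w\in X$ equal to $v$ or joined to $v$ by a sequence in $X$ of consecutively adjacent vertices; $\Gamma_\xi(v)=\gamma_{\xi^{ -1}(\xi(v))}(v)$. $\mathcal{G}(\xi)$ is the digraph with vertex set $\{\Gamma_\xi(v): v\in V(G)\}$ and arcs $(\mathfrak{a},\mathfrak{b})$ whenever some $a\in\mathfrak{a}$, $b\in\mathfrak{b}$ satisfy $ab\in A(G)$; $\iota_\xi:V(\mathcal{G}(\xi))\to V(H)$ is given by $\Gamma_\xi(v)\mapsto\xi(v)$ (well defined since $\xi$ is constant on each $\Gamma_\xi(v)$), and it is a homomorphism. -}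

module Defs where

open import Data.Nat using (ℕ; suc)
open import Data.Fin using (Fin)
open import Data.Product using (Σ; Σ-syntax; ∃; _×_)
open import Data.Sum using (_⊎_)
open import Relation.Binary.PropositionalEquality using (_≡_)
open import Relation.Nullary using (¬_)

record Digraph : Set₁ where
  field
    n   : ℕ
    Arc : Fin (suc n) → Fin (suc n) → Set

open Digraph public

V : Digraph → Set
V G = Fin (suc (n G))

Hom : Digraph → Digraph → Set
Hom G H = Σ (V G → V H) λ ξ → ∀ v w → Arc G v w → Arc H (ξ v) (ξ w)

Adjacent : (G : Digraph) → V G → V G → Set
Adjacent G v w = Arc G v w ⊎ Arc G w v

-- γ_X(v) as a predicate: γ G X v w means w ∈ γ_X(v), i.e. w = v or w is
-- joined to v by a sequence in X of consecutively adjacent vertices.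
data γ (G : Digraph) (X : V G → Set) (v : V G) : V G → Set where
  γ-here : γ G X v v
  γ-step : ∀ {u w} → γ G X v u → Adjacent G u w → X w → γ G X v w

Fiber : (G H : Digraph) → (V G → V H) → V G → V G → Set
Fiber G H ξ v w = ξ w ≡ ξ v

Γ : (G H : Digraph) → (V G → V H) → V G → V G → Set
Γ G H ξ v = γ G (Fiber G H ξ v) v

ΓEq : (G H : Digraph) → (V G → V H) → V G → V G → Set
ΓEq G H ξ v w = ∀ (u : V G) → (Γ G H ξ v u → Γ G H ξ w u) × (Γ G H ξ w u → Γ G H ξ v u)

-- The digraph 𝒢(ξ), presented via representatives: the vertex Γ_ξ(v) is
-- represented by v ∈ V(G); two representatives denote the same vertex iff
-- their Γ-sets are equal (ΓEq).
𝒢Arc : (G H : Digraph) → (V G → V H) → V G → V G → Set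
𝒢Arc G H ξ v w = Σ[ a ∈ V G ] Σ[ b ∈ V G ] (Γ G H ξ v a × Γ G H ξ w b × Arc G a b)

ι : (G H : Digraph) → (ξ : V G → V H) → V G → V H
ι G H ξ v = ξ v

ιStrict : (G H : Digraph) → (V G → V H) → Set
ιStrict G H ξ = ∀ (v w : V G) → 𝒢Arc G H ξ v w → ¬ (ΓEq G H ξ v w) → ¬ (ι G H ξ v ≡ ι G H ξ w)

module Submission where

-- If ι_ξ identified the endpoints of an arc Γ_ξ(v) → Γ_ξ(w), then v and w lie in
-- the same fibre of ξ, and the arc ab between them, with a ∈ Γ_ξ(v) and b ∈ Γ_ξ(w),
-- joins the two components inside that fibre; hence Γ_ξ(v) = Γ_ξ(w).

open import Defs
open import Data.Product using (proj₁; _,_; _×_)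
open import Data.Sum using (inj₁; inj₂)
open import Relation.Binary.PropositionalEquality using (_≡_; refl; sym; trans)

Adjacent-sym : (G : Digraph) {u w : V G} → Adjacent G u w → Adjacent G w u
Adjacent-sym G (inj₁ uw) = inj₂ uw
Adjacent-sym G (inj₂ wu) = inj₁ wu

γ-mono : ∀ {G : Digraph} {X Y : V G → Set} → (∀ x → X x → Y x) →
         ∀ {v u} → γ G X v u → γ G Y v u
γ-mono X⊆Y γ-here         = γ-here
γ-mono X⊆Y (γ-step p a x) = γ-step (γ-mono X⊆Y p) a (X⊆Y _ x)

module _ {G : Digraph} {X : V G → Set} where

  γ-trans : ∀ {v u w} → γ G X v u → γ G X u w → γ G X v w
  γ-trans p γ-here         = p
  γ-trans p (γ-step q a x) = γ-step (γ-trans p q) a x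

  γ-closed : ∀ {v u} → X v → γ G X v u → X u
  γ-closed xv γ-here         = xv
  γ-closed xv (γ-step _ _ x) = x

  γ-sym : ∀ {v u} → X v → γ G X v u → γ G X u v
  γ-sym xv γ-here         = γ-here
  γ-sym xv (γ-step p a _) =
    γ-trans (γ-step γ-here (Adjacent-sym G a) (γ-closed xv p)) (γ-sym xv p)

  γ-join : ∀ {v w a b} → X v → X w →
           γ G X v a → Adjacent G a b → γ G X w b → γ G X v w
  γ-join xv xw va ab wb = γ-trans (γ-step va ab (γ-closed xw wb)) (γ-sym xw wb)

  γ-same-component : ∀ {v w} → X v → γ G X v w →
                     ∀ u → (γ G X v u → γ G X w u) × (γ G X w u → γ G X v u)
  γ-same-component xv vw u = γ-trans (γ-sym xv vw) , γ-trans vw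

Fiber-cong : ∀ {G H : Digraph} {ξ : V G → V H} {v w : V G} → ξ v ≡ ξ w →
             ∀ x → Fiber G H ξ v x → Fiber G H ξ w x
Fiber-cong ξv≡ξw x ξx≡ξv = trans ξx≡ξv ξv≡ξw

corollary4 : (G H : Digraph) (ξ : Hom G H) → ιStrict G H (proj₁ ξ)
corollary4 G H (ξ , _) v w (a , b , va , wb , ab) Γv≢Γw ξv≡ξw = Γv≢Γw Γv≈Γw
  where
  Fv⊆Fw : ∀ x → Fiber G H ξ v x → Fiber G H ξ w x
  Fv⊆Fw = Fiber-cong {G} {H} {ξ} ξv≡ξw
  Fw⊆Fv : ∀ x → Fiber G H ξ w x → Fiber G H ξ v x
  Fw⊆Fv = Fiber-cong {G} {H} {ξ} (sym ξv≡ξw)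

  v-joins-w : γ G (Fiber G H ξ v) v w
  v-joins-w = γ-join refl (sym ξv≡ξw) va (inj₁ ab) (γ-mono Fw⊆Fv wb)

  Γv≈Γw : ΓEq G H ξ v w
  Γv≈Γw u with γ-same-component refl v-joins-w u
  ... | to , from = (λ p → γ-mono Fv⊆Fw (to p)) , (λ p → from (γ-mono Fw⊆Fv p))
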